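{- Let $G_1,G_2$ be positive integers and let $(G_n)_{n\geq1}$ be the Gibonacci sequence defined by $G_n=G_{n-1}+G_{n-2}$ for $n\geq3$. Define $a_0^{\{G_1,G_2\}}(n)=G_n$ for $n\geq1$, and for $k\geq1$ define $a_k^{\{G_1,G_2\}}(n)=\sum_{i=1}^{n}a_{k-1}^{\{G_1,G_2\}}(i)$ for $n\geq1$. Then for all integers $n,k\geq1$, \[a_k^{\{G_1,G_2\}}(n)=a_{k-1}^{\{G_1,G_2\}}(n+2)-\binom{n+k-1}{k-1}G_2-\binom{n+k-1}{k-2}G_1.\]
   Context: Binomial coefficient convention: for integers $m\geq0$ and $j<0$, $\binom{m}{j}=0$; and $\binom{0}{0}=1$. -}

module Defs where

open import Data.Nat using (ℕ; zero; suc; _+_)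
open import Data.Nat.Combinatorics using (_C_)
open import Data.Integer using (ℤ; +_; -[1+_])

-- Gibonacci sequence G_n (n ≥ 1) with G_1 = g1, G_2 = g2,
-- G_n = G_{n-1} + G_{n-2} for n ≥ 3.  The value at index 0 is a
-- dummy (never used by the statement); we set it to 0.
gib : ℕ → ℕ → ℕ → ℕ
gib g1 g2 zero = 0
gib g1 g2 (suc zero) = g1
gib g1 g2 (suc (suc zero)) = g2
gib g1 g2 (suc (suc (suc n))) = gib g1 g2 (suc (suc n)) + gib g1 g2 (suc n)

sumFrom1 : ℕ → (ℕ → ℕ) → ℕ
sumFrom1 zero f = 0
sumFrom1 (suc n) f = sumFrom1 n f + f (suc n)

a : ℕ → ℕ → ℕ → ℕ → ℕ
a g1 g2 zero n = gib g1 g2 n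
a g1 g2 (suc k) n = sumFrom1 n (a g1 g2 k)

binom : ℕ → ℤ → ℕ
binom m (+ j) = m C j
binom m -[1+ j ] = 0

{-# OPTIONS --safe #-}
-- Summing the recurrence gives G_1 + … + G_n = G_{n+2} − G_2, the case k = 1.
-- In general a_k(n+1) = a_k(n) + a_{k-1}(n+1), so induction on k and n
-- reduces the identity to Pascal's rule for both binomial coefficients.
-- It is proved in ℕ with the binomial terms on the left, where no
-- subtraction occurs, and transported to ℤ at the end.
module Submission where

open import Defs
open import Data.Nat using (ℕ; _≥_; _∸_; zero; suc; z≤n) renaming (_+_ to _+ℕ_; _*_ to _*ℕ_)
open import Data.Nat.Properties using (+-suc; +-comm; +-identityʳ; *-identityˡ; m+n∸n≡m; n≤1+n)
open import Data.Nat.Combinatorics using (_C_; nCn≡1; nC1≡n; nCk≡nC[n∸k]; nCk+nC[k+1]≡[n+1]C[k+1])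
open import Data.Nat.Tactic.RingSolver using (solve-∀)
open import Algebra.Properties.CommutativeSemigroup Data.Nat.Properties.+-commutativeSemigroup
  using (x∙yz≈y∙xz; xy∙z≈xz∙y)
open import Data.Integer using (+_; _-_; _*_) renaming (_+_ to _+ℤ_)
open import Data.Integer.Properties using (pos-+; pos-*)
import Data.Integer.Tactic.RingSolver as ℤ-Solver
open import Relation.Binary.PropositionalEquality using (_≡_; refl; sym; trans; cong; cong₂)
open Relation.Binary.PropositionalEquality.≡-Reasoning

nC0≡1 : ∀ n → n C 0 ≡ 1
nC0≡1 n = trans (nCk≡nC[n∸k] {k = 0} {n = n} z≤n) (nCn≡1 n)

[1+n]Cn≡1+n : ∀ n → suc n C n ≡ suc n
[1+n]Cn≡1+n n = begin
  suc n C n             ≡⟨ nCk≡nC[n∸k] (n≤1+n n) ⟩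
  suc n C (suc n ∸ n)   ≡⟨ cong (suc n C_) (m+n∸n≡m 1 n) ⟩
  suc n C 1             ≡⟨ nC1≡n (suc n) ⟩
  suc n                 ∎

choosePred : ℕ → ℕ → ℕ
choosePred m zero    = 0
choosePred m (suc j) = m C j

binom-pred : ∀ m j → binom m (+ suc j - + 2) ≡ choosePred m j
binom-pred m zero    = refl
binom-pred m (suc j) = refl

choosePred-pascal : ∀ m j → choosePred (suc m) (suc j) ≡ choosePred m j +ℕ choosePred m (suc j)
choosePred-pascal m zero    = trans (nC0≡1 (suc m)) (sym (nC0≡1 m))
choosePred-pascal m (suc j) = sym (nCk+nC[k+1]≡[n+1]C[k+1] m j)

choosePred-diag : ∀ n → choosePred n n ≡ n
choosePred-diag zero    = refl
choosePred-diag (suc n) = [1+n]Cn≡1+n n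

module _ (g₁ g₂ : ℕ) where

  a-at-1 : ∀ k → a g₁ g₂ k 1 ≡ g₁
  a-at-1 zero    = refl
  a-at-1 (suc k) = a-at-1 k

  a-at-2 : ∀ k → a g₁ g₂ k 2 ≡ g₂ +ℕ k *ℕ g₁
  a-at-2 zero    = sym (+-identityʳ g₂)
  a-at-2 (suc k) = begin
    0 +ℕ a g₁ g₂ k 1 +ℕ a g₁ g₂ k 2   ≡⟨ cong₂ (λ u v → 0 +ℕ u +ℕ v) (a-at-1 k) (a-at-2 k) ⟩
    g₁ +ℕ (g₂ +ℕ k *ℕ g₁)             ≡⟨ x∙yz≈y∙xz g₁ g₂ (k *ℕ g₁) ⟩
    g₂ +ℕ suc k *ℕ g₁                 ∎

  sum-gib : ∀ n → sumFrom1 n (gib g₁ g₂) +ℕ g₂ ≡ gib g₁ g₂ (suc (suc n))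
  sum-gib zero    = refl
  sum-gib (suc n) = begin
    s +ℕ gib g₁ g₂ (suc n) +ℕ g₂   ≡⟨ xy∙z≈xz∙y s (gib g₁ g₂ (suc n)) g₂ ⟩
    s +ℕ g₂ +ℕ gib g₁ g₂ (suc n)   ≡⟨ cong (_+ℕ gib g₁ g₂ (suc n)) (sum-gib n) ⟩
    gib g₁ g₂ (suc (suc (suc n)))  ∎
    where s = sumFrom1 n (gib g₁ g₂)

  a-suc-shift : ∀ k n →
    a g₁ g₂ (suc k) n +ℕ ((n +ℕ k) C k) *ℕ g₂ +ℕ choosePred (n +ℕ k) k *ℕ g₁ ≡ a g₁ g₂ k (n +ℕ 2)
  a-suc-shift zero n = begin
    a g₁ g₂ 1 n +ℕ ((n +ℕ 0) C 0) *ℕ g₂ +ℕ 0   ≡⟨ cong (λ c → a g₁ g₂ 1 n +ℕ c *ℕ g₂ +ℕ 0) (nC0≡1 (n +ℕ 0)) ⟩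
    a g₁ g₂ 1 n +ℕ 1 *ℕ g₂ +ℕ 0                ≡⟨ +-identityʳ _ ⟩
    a g₁ g₂ 1 n +ℕ 1 *ℕ g₂                     ≡⟨ cong (a g₁ g₂ 1 n +ℕ_) (*-identityˡ g₂) ⟩
    a g₁ g₂ 1 n +ℕ g₂                          ≡⟨ sum-gib n ⟩
    gib g₁ g₂ (2 +ℕ n)                         ≡⟨ cong (gib g₁ g₂) (+-comm 2 n) ⟩
    gib g₁ g₂ (n +ℕ 2)                         ∎
  a-suc-shift (suc k) zero = begin
    0 +ℕ (suc k C suc k) *ℕ g₂ +ℕ choosePred (suc k) (suc k) *ℕ g₁
      ≡⟨ cong₂ (λ c d → 0 +ℕ c *ℕ g₂ +ℕ d *ℕ g₁) (nCn≡1 (suc k)) (choosePred-diag (suc k)) ⟩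
    1 *ℕ g₂ +ℕ suc k *ℕ g₁        ≡⟨ cong (_+ℕ suc k *ℕ g₁) (*-identityˡ g₂) ⟩
    g₂ +ℕ suc k *ℕ g₁             ≡⟨ sym (a-at-2 (suc k)) ⟩
    a g₁ g₂ (suc k) 2             ∎
  a-suc-shift (suc k) (suc n) = begin
    x +ℕ y +ℕ (suc m C suc k) *ℕ g₂ +ℕ choosePred (suc m) (suc k) *ℕ g₁
      ≡⟨ cong₂ (λ c d → x +ℕ y +ℕ c *ℕ g₂ +ℕ d *ℕ g₁)
               (sym (nCk+nC[k+1]≡[n+1]C[k+1] m k)) (choosePred-pascal m k) ⟩
    x +ℕ y +ℕ (m C k +ℕ m C suc k) *ℕ g₂ +ℕ (choosePred m k +ℕ choosePred m (suc k)) *ℕ g₁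
      ≡⟨ regroup x y (m C k) (m C suc k) (choosePred m k) (choosePred m (suc k)) g₂ g₁ ⟩
    (x +ℕ (m C suc k) *ℕ g₂ +ℕ choosePred m (suc k) *ℕ g₁) +ℕ (y +ℕ (m C k) *ℕ g₂ +ℕ choosePred m k *ℕ g₁)
      ≡⟨ cong₂ _+ℕ_ (a-suc-shift (suc k) n) shifted ⟩
    a g₁ g₂ (suc k) (n +ℕ 2) +ℕ a g₁ g₂ k (suc n +ℕ 2)
      ∎
    where
    m = n +ℕ suc k
    x = a g₁ g₂ (suc (suc k)) n
    y = a g₁ g₂ (suc k) (suc n)
    regroup : ∀ x y p q r s u v →
      x +ℕ y +ℕ (p +ℕ q) *ℕ u +ℕ (r +ℕ s) *ℕ v ≡ (x +ℕ q *ℕ u +ℕ s *ℕ v) +ℕ (y +ℕ p *ℕ u +ℕ r *ℕ v)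
    regroup = solve-∀
    shifted : y +ℕ (m C k) *ℕ g₂ +ℕ choosePred m k *ℕ g₁ ≡ a g₁ g₂ k (suc n +ℕ 2)
    shifted rewrite +-suc n k = a-suc-shift k (suc n)

x+y+z≡w⇒x≡w-y-z : ∀ {x y z w} → x +ℕ y +ℕ z ≡ w → + x ≡ + w - + y - + z
x+y+z≡w⇒x≡w-y-z {x} {y} {z} refl = begin
  + x                             ≡⟨ add-sub-cancel (+ x) (+ y) (+ z) ⟩
  + x +ℤ + y +ℤ + z - + y - + z   ≡⟨ cong (λ t → t - + y - + z) (sym (pos-+-+ x y z)) ⟩
  + (x +ℕ y +ℕ z) - + y - + z     ∎
  where
  add-sub-cancel : ∀ p q r → p ≡ p +ℤ q +ℤ r - q - r
  add-sub-cancel = ℤ-Solver.solve-∀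
  pos-+-+ : ∀ x y z → + (x +ℕ y +ℕ z) ≡ + x +ℤ + y +ℤ + z
  pos-+-+ x y z = trans (pos-+ (x +ℕ y) z) (cong (_+ℤ + z) (pos-+ x y))

corollary2p4 : (G₁ G₂ : ℕ) → G₁ ≥ 1 → G₂ ≥ 1 → (n k : ℕ) → n ≥ 1 → k ≥ 1 →
    + a G₁ G₂ k n ≡ + a G₁ G₂ (k ∸ 1) (n +ℕ 2) - + binom (n +ℕ k ∸ 1) (+ k - + 1) * + G₂ - + binom (n +ℕ k ∸ 1) (+ k - + 2) * + G₁
corollary2p4 G₁ G₂ _ _ n (suc k) _ _
  rewrite +-suc n k
        | binom-pred (n +ℕ k) k
        | sym (pos-* ((n +ℕ k) C k) G₂)
        | sym (pos-* (choosePred (n +ℕ k) k) G₁)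
  = x+y+z≡w⇒x≡w-y-z (a-suc-shift G₁ G₂ k n)
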